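{- Let $G=(V,E)$ be a finite graph whose edges are colored with two colors $1,2$. Then $G$ has a majority partition with $4$ sets, i.e. there is a partition $V=V_1\cup V_2\cup V_3\cup V_4$ into $4$ pairwise disjoint sets such that for every color $c\in\{1,2\}$, every $i\in[4]$ and every $v\in V_i$ we have $d_{c,V_i}(v)\le d_{c,V\setminus V_i}(v)$.
   Context: For a vertex $v$, a set $X\subseteq V$ and a color $c$, $d_{c,X}(v)$ denotes the number of edges $vx$ of color $c$ with $x\in X$. -}

module Defs where

open import Data.Nat using (ℕ; zero; suc; _+_; _≤_)
open import Data.Fin using (Fin; _≟_)
open import Data.Maybe using (Maybe; just; nothing)
open import Data.Product using (_×_)
open import Relation.Binary.PropositionalEquality using (_≡_)
open import Relation.Nullary using (Dec; yes; no; ¬_)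

-- A finite simple graph on vertex set Fin n whose edges are coloured with
-- two colours (Fin 2).  col u v = nothing  means uv is not an edge;
-- col u v = just c  means uv is an edge of colour c.
record EdgeColouredGraph (n : ℕ) : Set where
  field
    col       : Fin n → Fin n → Maybe (Fin 2)
    symmetric : ∀ u v → col u v ≡ col v u
    loopless  : ∀ v → col v v ≡ nothing

open EdgeColouredGraph public

count : ∀ {n} {P : Fin n → Set} → (∀ x → Dec (P x)) → ℕ
count {zero}  P? = 0
count {suc n} {P} P? with P? Data.Fin.zero
... | yes _ = suc (count {n} (λ x → P? (Data.Fin.suc x)))
... | no  _ = count {n} (λ x → P? (Data.Fin.suc x))

isColour : ∀ (m : Maybe (Fin 2)) (c : Fin 2) → Dec (m ≡ just c)
isColour nothing  c = no (λ ())
isColour (just d) c with d ≟ c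
... | yes Relation.Binary.PropositionalEquality.refl = yes Relation.Binary.PropositionalEquality.refl
... | no ¬p = no (λ { Relation.Binary.PropositionalEquality.refl → ¬p Relation.Binary.PropositionalEquality.refl })

deg : ∀ {n} (G : EdgeColouredGraph n) (c : Fin 2)
      (X : Fin n → Set) (X? : ∀ x → Dec (X x)) (v : Fin n) → ℕ
deg G c X X? v = count (λ x → decAnd (isColour (col G v x) c) (X? x))
  where
  decAnd : ∀ {A B : Set} → Dec A → Dec B → Dec (A × B)
  decAnd (yes a) (yes b) = yes (a Data.Product., b)
  decAnd (no ¬a) _       = no (λ p → ¬a (Data.Product.proj₁ p))
  decAnd (yes _) (no ¬b) = no (λ p → ¬b (Data.Product.proj₂ p))

-- A partition of V = Fin n into k pairwise disjoint (possibly empty) sets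
-- V_1,…,V_k is a map p : Fin n → Fin k, with V_i = { v | p v ≡ i }.
IsMajorityPartition : ∀ {n k} → EdgeColouredGraph n → (Fin n → Fin k) → Set
IsMajorityPartition {n} G p =
  ∀ (c : Fin 2) (i : Fin _) (v : Fin n) → p v ≡ i →
    deg G c (λ x → p x ≡ i) (λ x → p x ≟ i) v
      ≤ deg G c (λ x → ¬ (p x ≡ i)) (λ x → Relation.Nullary.¬? (p x ≟ i)) v

{-# OPTIONS --safe #-}

-- For a single colour, a bipartition in which every vertex has at most as many neighbours on
-- its own side as on the other exists by local search: moving a vertex that violates this
-- lowers the (doubled) weight of monochromatic edges by twice the violation.  Take one such
-- bipartition r₁, r₂ per colour; the four classes of x ↦ (r₁ x, r₂ x) form a majority
-- partition, since refining a partition only shrinks the own class of each vertex and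
-- enlarges its complement.

module Submission where

open import Defs
open import Data.Nat using (ℕ)
open import Data.Fin using (Fin)
open import Data.Product using (Σ)

open import Data.Bool.Base using (if_then_else_)
open import Data.Fin.Base using (zero; suc; combine; opposite)
open import Data.Fin.Properties using (_≟_; all?; ¬∀⟶∃¬; combine-injectiveˡ; combine-injectiveʳ)
open import Data.Nat.Base using (zero; suc; _+_; _*_; _≤_; _<_; z≤n)
open import Data.Nat.Induction using (<-wellFounded)
open import Data.Nat.Properties
  using (_≤?_; ≤-refl; ≤-antisym; ≰⇒>; +-identityʳ; +-mono-≤; +-mono-<; +-monoʳ-<;
         +-cancelʳ-<; *-monoʳ-≤; +-*-semiring; module ≤-Reasoning)
open import Data.Nat.Tactic.RingSolver using (solve-∀)
open import Data.Product.Base using (_×_; _,_; proj₁; proj₂; ∃; ∃-syntax)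
open import Data.Sum.Base using (_⊎_; inj₁; inj₂)
open import Data.Vec.Functional using (updateAt)
open import Data.Vec.Functional.Properties using (updateAt-updates; updateAt-minimal)
open import Function.Base using (_∘_)
open import Induction.WellFounded using (Acc; acc)
open import Relation.Binary.PropositionalEquality
open import Relation.Nullary using (Dec; yes; no; does; ¬?; contradiction)

open import Algebra.Properties.Semiring.Sum +-*-semiring
  using (sum; sum-syntax; sum-cong-≗; sum-replicate-zero; ∑-distrib-+; *-distribˡ-sum)

private
  variable
    A B : Set
    n : ℕ

indicator : Dec A → ℕ
indicator a = if does a then 1 else 0

indicator-mono : (A → B) → (a : Dec A) (b : Dec B) → indicator a ≤ indicator b
indicator-mono _   (yes _) (yes _) = ≤-refl
indicator-mono A→B (yes a) (no ¬b) = contradiction (A→B a) ¬b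
indicator-mono _   (no _)  _       = z≤n

indicator-cong : (A → B) → (B → A) → (a : Dec A) (b : Dec B) → indicator a ≡ indicator b
indicator-cong A→B B→A a b = ≤-antisym (indicator-mono A→B a b) (indicator-mono B→A b a)

indicator-× : (a : Dec A) (b : Dec B) (ab : Dec (A × B)) →
              indicator ab ≡ indicator a * indicator b
indicator-× (yes a) (yes b) (yes _)  = refl
indicator-× (yes a) (yes b) (no ¬ab) = contradiction (a , b) ¬ab
indicator-× (yes _) (no ¬b) (yes ab) = contradiction (proj₂ ab) ¬b
indicator-× (yes _) (no _)  (no _)   = refl
indicator-× (no ¬a) _       (yes ab) = contradiction (proj₁ ab) ¬a
indicator-× (no _)  _       (no _)   = refl

indicator-opposite : (a b : Fin 2) → indicator (a ≟ opposite b) ≡ indicator (¬? (a ≟ b))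
indicator-opposite zero       zero       = refl
indicator-opposite zero       (suc zero) = refl
indicator-opposite (suc zero) zero       = refl
indicator-opposite (suc zero) (suc zero) = refl

count≡∑indicator : {P : Fin n → Set} (P? : ∀ x → Dec (P x)) →
                   count P? ≡ ∑[ x < n ] indicator (P? x)
count≡∑indicator {zero}  P? = refl
count≡∑indicator {suc n} P? with P? zero
... | yes _ = cong suc (count≡∑indicator (P? ∘ suc))
... | no  _ = count≡∑indicator (P? ∘ suc)

count-× : {P Q : Fin n → Set} (P? : ∀ x → Dec (P x)) (Q? : ∀ x → Dec (Q x))
          (P×Q? : ∀ x → Dec (P x × Q x)) →
          count P×Q? ≡ ∑[ x < n ] (indicator (P? x) * indicator (Q? x))
count-× P? Q? P×Q? =
  trans (count≡∑indicator P×Q?) (sum-cong-≗ (λ x → indicator-× (P? x) (Q? x) (P×Q? x)))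

∑-mono : {f g : Fin n → ℕ} → (∀ i → f i ≤ g i) → sum f ≤ sum g
∑-mono {zero}  f≤g = z≤n
∑-mono {suc n} f≤g = +-mono-≤ (f≤g zero) (∑-mono (f≤g ∘ suc))

∑-select : (g : Fin n → ℕ) (v : Fin n) → ∑[ u < n ] (indicator (u ≟ v) * g u) ≡ g v
∑-select {suc n} g zero    =
  trans (cong₂ _+_ (+-identityʳ (g zero)) (sum-replicate-zero n)) (+-identityʳ (g zero))
∑-select {suc n} g (suc v) = ∑-select (g ∘ suc) v

∑∑-distrib-+ : (H K : Fin n → Fin n → ℕ) →
               ∑[ u < n ] ∑[ x < n ] (H u x + K u x)
                 ≡ ∑[ u < n ] ∑[ x < n ] H u x + ∑[ u < n ] ∑[ x < n ] K u x
∑∑-distrib-+ H K =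
  trans (sum-cong-≗ (λ u → ∑-distrib-+ (H u) (K u))) (∑-distrib-+ (sum ∘ H) (sum ∘ K))

∑∑-row+column : (H K : Fin n → Fin n → ℕ) (v : Fin n) →
  ∑[ u < n ] ∑[ x < n ] (H u x + (indicator (u ≟ v) * K u x + indicator (x ≟ v) * K u x))
    ≡ ∑[ u < n ] ∑[ x < n ] H u x + (∑[ x < n ] K v x + ∑[ u < n ] K u v)
∑∑-row+column {n} H K v = begin
  ∑[ u < n ] ∑[ x < n ] (H u x + (R u x + C u x))  ≡⟨ ∑∑-distrib-+ H (λ u x → R u x + C u x) ⟩
  ∑∑H + ∑[ u < n ] ∑[ x < n ] (R u x + C u x)      ≡⟨ cong (∑∑H +_) (∑∑-distrib-+ R C) ⟩
  ∑∑H + (∑[ u < n ] ∑[ x < n ] R u x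
         + ∑[ u < n ] ∑[ x < n ] C u x)           ≡⟨ cong (∑∑H +_) (cong₂ _+_ row column) ⟩
  ∑∑H + (∑[ x < n ] K v x + ∑[ u < n ] K u v)      ∎
  where
  open ≡-Reasoning
  ∑∑H = ∑[ u < n ] ∑[ x < n ] H u x
  R C : Fin n → Fin n → ℕ
  R u x = indicator (u ≟ v) * K u x
  C u x = indicator (x ≟ v) * K u x
  row : ∑[ u < n ] ∑[ x < n ] R u x ≡ ∑[ x < n ] K v x
  row = trans (sum-cong-≗ (λ u → sym (*-distribˡ-sum (indicator (u ≟ v)) (K u))))
              (∑-select (sum ∘ K) v)
  column : ∑[ u < n ] ∑[ x < n ] C u x ≡ ∑[ u < n ] K u v
  column = sum-cong-≗ (λ u → ∑-select (K u) v)

∃-by-descent : {P : A → Set} (Φ : A → ℕ) → (∀ a → P a ⊎ ∃[ b ] Φ b < Φ a) → A → ∃ P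
∃-by-descent {A = A} {P = P} Φ step a = go a (<-wellFounded (Φ a))
  where
  go : ∀ a → Acc _<_ (Φ a) → ∃ P
  go a (acc rs) with step a
  ... | inj₁ pa           = a , pa
  ... | inj₂ (b , Φb<Φa) = go b (rs Φb<Φa)

sameClass : ∀ {k} (p : Fin n → Fin k) (v x : Fin n) → Dec (p x ≡ p v)
sameClass p v x = p x ≟ p v

otherClass : ∀ {k} (p : Fin n → Fin k) (v x : Fin n) → Dec (p x ≢ p v)
otherClass p v x = ¬? (p x ≟ p v)

module WeightedGraph {n : ℕ} (w : Fin n → Fin n → ℕ) where

  degree : Fin n → {X : Fin n → Set} → (∀ x → Dec (X x)) → ℕ
  degree v X? = ∑[ x < n ] (w v x * indicator (X? x))

  degree-mono : ∀ v {X Y : Fin n → Set} (X? : ∀ x → Dec (X x)) (Y? : ∀ x → Dec (Y x)) →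
                (∀ x → X x → Y x) → degree v X? ≤ degree v Y?
  degree-mono v X? Y? X⊆Y =
    ∑-mono (λ x → *-monoʳ-≤ (w v x) (indicator-mono (X⊆Y x) (X? x) (Y? x)))

  IsMajority : ∀ {k} → (Fin n → Fin k) → Set
  IsMajority p = ∀ v → degree v (sameClass p v) ≤ degree v (otherClass p v)

  IsMajority-refine : ∀ {k m} {p : Fin n → Fin k} {r : Fin n → Fin m} →
                      (∀ x y → p x ≡ p y → r x ≡ r y) → IsMajority r → IsMajority p
  IsMajority-refine {p = p} {r} p⇒r maj v = begin
    degree v (sameClass p v)   ≤⟨ degree-mono v (sameClass p v) (sameClass r v) (λ x → p⇒r x v) ⟩
    degree v (sameClass r v)   ≤⟨ maj v ⟩
    degree v (otherClass r v)  ≤⟨ degree-mono v (otherClass r v) (otherClass p v) r≢⇒p≢ ⟩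
    degree v (otherClass p v)  ∎
    where
    open ≤-Reasoning
    r≢⇒p≢ : ∀ x → r x ≢ r v → p x ≢ p v
    r≢⇒p≢ x r≢ p≡ = r≢ (p⇒r x v p≡)

  module _ (w-sym : ∀ u x → w u x ≡ w x u) (w-loop : ∀ v → w v v ≡ 0) where

    flipAt : (Fin n → Fin 2) → Fin n → Fin n → Fin 2
    flipAt q v = updateAt q v opposite

    monochromatic : (Fin n → Fin 2) → Fin n → Fin n → ℕ
    monochromatic q u x = w u x * indicator (q x ≟ q u)

    potential : (Fin n → Fin 2) → ℕ
    potential q = ∑[ u < n ] ∑[ x < n ] monochromatic q u x

    column≡degree : ∀ q v → ∑[ u < n ] monochromatic q u v ≡ degree v (sameClass q v)
    column≡degree q v = sum-cong-≗ λ u →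
      cong₂ _*_ (w-sym u v) (indicator-cong sym sym (q v ≟ q u) (q u ≟ q v))

    flipAt-degree : ∀ q v → degree v (sameClass (flipAt q v) v) ≡ degree v (otherClass q v)
    flipAt-degree q v = sum-cong-≗ term
      where
      term : ∀ x → w v x * indicator (flipAt q v x ≟ flipAt q v v)
                     ≡ w v x * indicator (¬? (q x ≟ q v))
      term x with x ≟ v
      ... | yes refl rewrite w-loop x = refl
      ... | no x≢v
        rewrite updateAt-minimal x v {opposite} q x≢v | updateAt-updates v {opposite} q
        = cong (w v x *_) (indicator-opposite (q x) (q v))

    -- Entrywise form of potential-flipAt: flipping v changes only row v and column v.
    flipAt-exchange : ∀ q v u x → let q′ = flipAt q v in
      monochromatic q′ u x + (indicator (u ≟ v) * monochromatic q u x
                              + indicator (x ≟ v) * monochromatic q u x)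
        ≡ monochromatic q u x + (indicator (u ≟ v) * monochromatic q′ u x
                                 + indicator (x ≟ v) * monochromatic q′ u x)
    flipAt-exchange q v u x with u ≟ v | x ≟ v
    ... | yes refl | yes refl rewrite w-loop u = refl
    ... | yes _    | no _     = swap-row (monochromatic (flipAt q v) u x) (monochromatic q u x)
      where
      swap-row : ∀ a b → a + (1 * b + 0 * b) ≡ b + (1 * a + 0 * a)
      swap-row = solve-∀
    ... | no _     | yes _    = swap-column (monochromatic (flipAt q v) u x) (monochromatic q u x)
      where
      swap-column : ∀ a b → a + (0 * b + 1 * b) ≡ b + (0 * a + 1 * a)
      swap-column = solve-∀
    ... | no u≢v   | no x≢v
      rewrite updateAt-minimal u v {opposite} q u≢v
            | updateAt-minimal x v {opposite} q x≢v = refl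

    potential-flipAt : ∀ q v →
      potential (flipAt q v) + (degree v (sameClass q v) + degree v (sameClass q v))
        ≡ potential q + (degree v (otherClass q v) + degree v (otherClass q v))
    potential-flipAt q v = begin
      potential q′ + (same + same)
        ≡⟨ cong (λ t → potential q′ + (same + t)) (column≡degree q v) ⟨
      potential q′ + (same + ∑[ u < n ] monochromatic q u v)
        ≡⟨ ∑∑-row+column (monochromatic q′) (monochromatic q) v ⟨
      ∑[ u < n ] ∑[ x < n ] _
        ≡⟨ sum-cong-≗ (λ u → sum-cong-≗ (flipAt-exchange q v u)) ⟩
      ∑[ u < n ] ∑[ x < n ] _
        ≡⟨ ∑∑-row+column (monochromatic q) (monochromatic q′) v ⟩
      potential q + (same′ + ∑[ u < n ] monochromatic q′ u v)
        ≡⟨ cong (λ t → potential q + (same′ + t)) (column≡degree q′ v) ⟩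
      potential q + (same′ + same′)
        ≡⟨ cong (λ t → potential q + (t + t)) (flipAt-degree q v) ⟩
      potential q + (other + other)
        ∎
      where
      open ≡-Reasoning
      q′ = flipAt q v
      same = degree v (sameClass q v)
      same′ = degree v (sameClass q′ v)
      other = degree v (otherClass q v)

    potential-flipAt-< : ∀ q v → degree v (otherClass q v) < degree v (sameClass q v) →
                         potential (flipAt q v) < potential q
    potential-flipAt-< q v other<same =
      +-cancelʳ-< (same + same) (potential (flipAt q v)) (potential q) (begin-strict
        potential (flipAt q v) + (same + same)  ≡⟨ potential-flipAt q v ⟩
        potential q + (other + other)           <⟨ +-monoʳ-< (potential q) (+-mono-< other<same other<same) ⟩
        potential q + (same + same)             ∎)
      where
      open ≤-Reasoning
      same = degree v (sameClass q v)
      other = degree v (otherClass q v)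

    majorityBipartition : Σ (Fin n → Fin 2) IsMajority
    majorityBipartition = ∃-by-descent potential improve (λ _ → zero)
      where
      majorityAt? : ∀ q v → Dec (degree v (sameClass q v) ≤ degree v (otherClass q v))
      majorityAt? q v = degree v (sameClass q v) ≤? degree v (otherClass q v)

      improve : ∀ q → IsMajority q ⊎ ∃[ q′ ] potential q′ < potential q
      improve q with all? (majorityAt? q)
      ... | yes majority = inj₁ majority
      ... | no ¬majority with (v , bad) ← ¬∀⟶∃¬ n _ (majorityAt? q) ¬majority
        = inj₂ (flipAt q v , potential-flipAt-< q v (≰⇒> bad))

open WeightedGraph using (degree; IsMajority; IsMajority-refine; majorityBipartition)

colourWeight : EdgeColouredGraph n → Fin 2 → Fin n → Fin n → ℕ
colourWeight G c u x = indicator (isColour (col G u x) c)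

colourWeight-sym : ∀ (G : EdgeColouredGraph n) c u x → colourWeight G c u x ≡ colourWeight G c x u
colourWeight-sym G c u x = cong (λ m → indicator (isColour m c)) (symmetric G u x)

colourWeight-loop : ∀ (G : EdgeColouredGraph n) c v → colourWeight G c v v ≡ 0
colourWeight-loop G c v rewrite loopless G v = refl

deg≡degree : ∀ (G : EdgeColouredGraph n) c {X : Fin n → Set} (X? : ∀ x → Dec (X x)) v →
             deg G c X X? v ≡ degree (colourWeight G c) v X?
deg≡degree G c X? v = count-× (λ x → isColour (col G v x) c) X? _

colourMajorityBipartition : ∀ (G : EdgeColouredGraph n) c →
                            Σ (Fin n → Fin 2) (IsMajority (colourWeight G c))
colourMajorityBipartition G c =
  majorityBipartition (colourWeight G c) (colourWeight-sym G c) (colourWeight-loop G c)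

mainTheorem1 : ∀ (n : ℕ) (G : EdgeColouredGraph n) →
    Σ (Fin n → Fin 4) (λ p → IsMajorityPartition G p)
mainTheorem1 n G = p , majority
  where
  r : Fin 2 → Fin n → Fin 2
  r c = proj₁ (colourMajorityBipartition G c)

  p : Fin n → Fin 4
  p x = combine (r zero x) (r (suc zero) x)

  p-refines : ∀ c x y → p x ≡ p y → r c x ≡ r c y
  p-refines zero       x y = combine-injectiveˡ (r zero x) (r (suc zero) x) (r zero y) (r (suc zero) y)
  p-refines (suc zero) x y = combine-injectiveʳ (r zero x) (r (suc zero) x) (r zero y) (r (suc zero) y)

  majority : IsMajorityPartition G p
  majority c i v refl =
    subst₂ _≤_ (sym (deg≡degree G c (sameClass p v) v)) (sym (deg≡degree G c (otherClass p v) v))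
      (IsMajority-refine (colourWeight G c) (p-refines c) (proj₂ (colourMajorityBipartition G c)) v)
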